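{- Let $k\in\mathbb{N}$. There exists an MSO transduction from (encodings of) graphs to enriched representations of decorated graphs with the following property: given a graph $G$, for every family $\mathcal{X}$ of subsets of $V(G)$, each of size at most $k$, such that $\mathcal{X}$ can be captured by some guidance system over $G$ colorable with $k$ colors, the transduction outputs some enriched representation of the $k$-decorated graph $G^{\mathcal{X}}$.
   Context: A guidance system over $G$ is a set $\Lambda$ of subtrees of $G$, each with a designated root; $\Lambda(w)$ is the set of roots of the trees of $\Lambda$ containing vertex $w$. A family $\mathcal{X}$ is captured by $\Lambda$ if every $X\in\mathcal{X}$ satisfies $X\subseteq\Lambda(w)$ for some vertex $w$. $\Lambda$ is $k$-colorable if its trees can be colored with $k$ colors so that same-colored trees are vertex-disjoint. A $k$-decorated graph is a graph $G$ with a family $\mathcal{X}$ of vertex subsets each of size at most $k$; it is represented as the structure $G^{\mathcal{X}}$ whose universe is $V(G)\cup E(G)$ plus one new element for each set in $\mathcal{X}$, with relations $\mathsf{incident}$ (vertex–edge incidence), unary $\mathsf{decoration}$ (the elements representing sets of $\mathcal{X}$), and binary $\mathsf{element}(v,X)$ ($v\in X\in\mathcal{X}$). An enriched representation additionally has binary predicates $\mathsf{element}_1,\dots,\mathsf{element}_k$ whose disjoint union is $\mathsf{element}$, such that for each $X$ and $i$ there is at most one $u$ with $\mathsf{element}_i(u,X)$. Graphs are encoded with universe $V\cup E$ and relation $\mathsf{incident}$. MSO transductions are finite compositions of copying, coloring (nondeterministically guessing unary predicates) and MSO interpretations. -}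

module Defs where

open import Level using (Lift; 0ℓ) renaming (suc to lsuc)
open import Data.Nat using (ℕ; zero; suc; _+_; _≤_)
open import Data.Fin using (Fin; zero; suc; splitAt)
open import Data.Fin.Subset using (Subset; _∈_; _-_; ∣_∣)
open import Data.Vec using (Vec; []; _∷_; map; lookup)
open import Data.Product using (Σ; ∃; ∃-syntax; _×_; _,_; proj₁; proj₂)
open import Data.Sum using (_⊎_; inj₁; inj₂)
open import Data.Empty using (⊥)
open import Data.Unit using (⊤; tt)
open import Relation.Nullary using (¬_)
open import Relation.Binary.PropositionalEquality using (_≡_; _≢_)
open import Function.Bundles using (_↔_; _⇔_; Inverse)
open import Function.Definitions using (Injective)

record Signature : Set₁ where
  field
    Sym   : Set
    arity : Sym → ℕ
open Signature public

record Structure (σ : Signature) : Set₁ where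
  field
    size : ℕ
    rel  : (R : Sym σ) → Vec (Fin size) (arity σ R) → Set
open Structure public

record _≅_ {σ : Signature} (A B : Structure σ) : Set where
  field
    bij  : Fin (size A) ↔ Fin (size B)
    pres : (R : Sym σ) (t : Vec (Fin (size A)) (arity σ R)) →
           rel A R t ⇔ rel B R (map (Inverse.to bij) t)

-- MSO formulas: i free first-order variables, j free set variables
-- (de Bruijn: the most recently bound variable is index zero)

data Formula (σ : Signature) (i j : ℕ) : Set where
  atom    : (R : Sym σ) → Vec (Fin i) (arity σ R) → Formula σ i j
  equal   : Fin i → Fin i → Formula σ i j
  member  : Fin i → Fin j → Formula σ i j
  true false : Formula σ i j
  not     : Formula σ i j → Formula σ i j
  and or implies : Formula σ i j → Formula σ i j → Formula σ i j
  exists₁ forall₁ : Formula σ (suc i) j → Formula σ i j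
  exists₂ forall₂ : Formula σ i (suc j) → Formula σ i j

extend : {A : Set} {n : ℕ} → (Fin n → A) → A → Fin (suc n) → A
extend ρ a zero    = a
extend ρ a (suc x) = ρ x

noVars : {A : Set} → Fin 0 → A
noVars ()

Sat : ∀ {σ i j} (A : Structure σ) → Formula σ i j →
      (Fin i → Fin (size A)) → (Fin j → Subset (size A)) → Set
Sat A (atom R xs)   ρ η = rel A R (map ρ xs)
Sat A (equal x y)   ρ η = ρ x ≡ ρ y
Sat A (member x X)  ρ η = ρ x ∈ η X
Sat A true          ρ η = ⊤
Sat A false         ρ η = ⊥
Sat A (not φ)       ρ η = ¬ Sat A φ ρ η
Sat A (and φ ψ)     ρ η = Sat A φ ρ η × Sat A ψ ρ η
Sat A (or φ ψ)      ρ η = Sat A φ ρ η ⊎ Sat A ψ ρ η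
Sat A (implies φ ψ) ρ η = Sat A φ ρ η → Sat A ψ ρ η
Sat A (exists₁ φ)   ρ η = Σ (Fin (size A)) λ a → Sat A φ (extend ρ a) η
Sat A (forall₁ φ)   ρ η = (a : Fin (size A)) → Sat A φ (extend ρ a) η
Sat A (exists₂ φ)   ρ η = Σ (Subset (size A)) λ S → Sat A φ ρ (extend η S)
Sat A (forall₂ φ)   ρ η = (S : Subset (size A)) → Sat A φ ρ (extend η S)

-- Atomic transductions (outputs are specified up to isomorphism)

data CopySym (σ : Signature) (c : ℕ) : Set where
  old   : Sym σ → CopySym σ c
  copy  : CopySym σ c
  layer : Fin c → CopySym σ c

copyArity : ∀ {σ c} → CopySym σ c → ℕ
copyArity {σ} (old R) = arity σ R
copyArity copy        = 2
copyArity (layer _)   = 1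

copySig : Signature → ℕ → Signature
copySig σ c = record { Sym = CopySym σ c ; arity = copyArity }

record CopyOut {σ : Signature} (c : ℕ) (A : Structure σ) (B : Structure (copySig σ c)) : Set where
  field
    g      : Fin (size B) ↔ (Fin c × Fin (size A))
    oldRel : (R : Sym σ) (t : Vec (Fin (size B)) (arity σ R)) →
             rel B (old R) t ⇔
             (Σ (Fin c) λ l → Σ (Vec (Fin (size A)) (arity σ R)) λ s →
               (map (Inverse.to g) t ≡ map (λ a → (l , a)) s) × rel A R s)
    copyRel : (a b : Fin (size B)) →
             rel B copy (a ∷ b ∷ []) ⇔ (proj₂ (Inverse.to g a) ≡ proj₂ (Inverse.to g b))
    layerRel : (l : Fin c) (a : Fin (size B)) →
             rel B (layer l) (a ∷ []) ⇔ (proj₁ (Inverse.to g a) ≡ l)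

colorArity : (σ : Signature) → Sym σ ⊎ ⊤ → ℕ
colorArity σ (inj₁ R) = arity σ R
colorArity σ (inj₂ _) = 1

colorSig : Signature → Signature
colorSig σ = record { Sym = Sym σ ⊎ ⊤ ; arity = colorArity σ }

record ColorOut {σ : Signature} (A : Structure σ) (B : Structure (colorSig σ)) : Set where
  field
    f      : Fin (size B) ↔ Fin (size A)
    oldRel : (R : Sym σ) (t : Vec (Fin (size B)) (arity σ R)) →
             rel B (inj₁ R) t ⇔ rel A R (map (Inverse.to f) t)
    -- the new unary predicate (inj₂ tt) is arbitrary

record Interpretation (σ τ : Signature) : Set where
  field
    domain  : Formula σ 1 0
    formula : (R : Sym τ) → Formula σ (arity τ R) 0

record InterpOut {σ τ : Signature} (I : Interpretation σ τ) (A : Structure σ) (B : Structure τ) : Set where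
  open Interpretation I
  field
    f      : Fin (size B) → Fin (size A)
    f-inj  : Injective _≡_ _≡_ f
    f-dom  : (b : Fin (size B)) → Sat A domain (λ _ → f b) noVars
    f-onto : (a : Fin (size A)) → Sat A domain (λ _ → a) noVars → Σ (Fin (size B)) λ b → f b ≡ a
    relOK  : (R : Sym τ) (t : Vec (Fin (size B)) (arity τ R)) →
             rel B R t ⇔ Sat A (formula R) (lookup (map f t)) noVars

data Transduction : Signature → Signature → Set₁ where
  identity  : ∀ {σ} → Transduction σ σ
  copying   : ∀ {σ} (c : ℕ) → Transduction σ (copySig σ c)
  coloring  : ∀ {σ} → Transduction σ (colorSig σ)
  interpret : ∀ {σ τ} → Interpretation σ τ → Transduction σ τ
  _⨾_       : ∀ {σ τ υ} → Transduction σ τ → Transduction τ υ → Transduction σ υ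

Out : ∀ {σ τ} → Transduction σ τ → Structure σ → Structure τ → Set₁
Out identity      A B = Lift (lsuc 0ℓ) (A ≅ B)
Out (copying c)   A B = Lift (lsuc 0ℓ) (CopyOut c A B)
Out coloring      A B = Lift (lsuc 0ℓ) (ColorOut A B)
Out (interpret I) A B = Lift (lsuc 0ℓ) (InterpOut I A B)
Out (T ⨾ U)       A B = Σ (Structure _) λ C → Out T A C × Out U C B

-- Graphs (finite, undirected; multiple edges and loops allowed)

record Graph : Set where
  field
    nV nE : ℕ
    ends  : Fin nE → Fin nV × Fin nV
open Graph public

Incident : (G : Graph) → Fin (nV G) → Fin (nE G) → Set
Incident G v e = (v ≡ proj₁ (ends G e)) ⊎ (v ≡ proj₂ (ends G e))

data GSym : Set where
  incident : GSym

GraphSig : Signature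
GraphSig = record { Sym = GSym ; arity = λ _ → 2 }

encRel : (G : Graph) (R : GSym) → Vec (Fin (nV G + nE G)) 2 → Set
encRel G incident (a ∷ b ∷ []) =
  Σ (Fin (nV G)) λ v → Σ (Fin (nE G)) λ e →
    (splitAt (nV G) a ≡ inj₁ v) × (splitAt (nV G) b ≡ inj₂ e) × Incident G v e

encode : Graph → Structure GraphSig
encode G = record { size = nV G + nE G ; rel = encRel G }

data Connected (G : Graph) (F : Subset (nE G)) : Fin (nV G) → Fin (nV G) → Set where
  here : ∀ {v} → Connected G F v v
  step : ∀ {u v w} (e : Fin (nE G)) → e ∈ F → Incident G u e → Incident G v e →
         Connected G F v w → Connected G F u w

-- a subtree of G: a connected acyclic subgraph (acyclic = every edge is a bridge)
record RootedSubtree (G : Graph) : Set where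
  field
    verts   : Subset (nV G)
    edges   : Subset (nE G)
    endsIn  : (e : Fin (nE G)) → e ∈ edges →
              (proj₁ (ends G e) ∈ verts) × (proj₂ (ends G e) ∈ verts)
    conn    : (u v : Fin (nV G)) → u ∈ verts → v ∈ verts → Connected G edges u v
    acyclic : (e : Fin (nE G)) → e ∈ edges →
              ¬ Connected G (edges - e) (proj₁ (ends G e)) (proj₂ (ends G e))
    root    : Fin (nV G)
    rootIn  : root ∈ verts
open RootedSubtree public

record GuidanceSystem (G : Graph) : Set where
  field
    count : ℕ
    tree  : Fin count → RootedSubtree G
open GuidanceSystem public

_∈Λ[_]_ : ∀ {G} → Fin (nV G) → GuidanceSystem G → Fin (nV G) → Set
x ∈Λ[ Λ ] w = Σ (Fin (count Λ)) λ i → (w ∈ verts (tree Λ i)) × (root (tree Λ i) ≡ x)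

Captures : ∀ {G d} → GuidanceSystem G → (Fin d → Subset (nV G)) → Set
Captures {G} Λ 𝒳 = ∀ X → Σ (Fin (nV G)) λ w → ∀ x → x ∈ 𝒳 X → x ∈Λ[ Λ ] w

Colorable : ∀ {G} → ℕ → GuidanceSystem G → Set
Colorable {G} k Λ = Σ (Fin (count Λ) → Fin k) λ col →
  ∀ i j → i ≢ j → col i ≡ col j →
  ∀ v → v ∈ verts (tree Λ i) → v ∈ verts (tree Λ j) → ⊥

data BaseDecSym : Set where
  incident decoration element : BaseDecSym

baseDecArity : BaseDecSym → ℕ
baseDecArity decoration = 1
baseDecArity _          = 2

BaseDecSig : Signature
BaseDecSig = record { Sym = BaseDecSym ; arity = baseDecArity }

data DecSym (k : ℕ) : Set where
  incident decoration element : DecSym k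
  elementAt : Fin k → DecSym k

decArity : ∀ {k} → DecSym k → ℕ
decArity decoration = 1
decArity _          = 2

DecSig : ℕ → Signature
DecSig k = record { Sym = DecSym k ; arity = decArity }

classify : (G : Graph) (d : ℕ) → Fin ((nV G + nE G) + d) → (Fin (nV G) ⊎ Fin (nE G)) ⊎ Fin d
classify G d a with splitAt (nV G + nE G) a
... | inj₂ X = inj₂ X
... | inj₁ b = inj₁ (splitAt (nV G) b)

decRel : (G : Graph) (d : ℕ) (𝒳 : Fin d → Subset (nV G)) (R : BaseDecSym) →
         Vec (Fin ((nV G + nE G) + d)) (baseDecArity R) → Set
decRel G d 𝒳 incident (a ∷ b ∷ []) =
  Σ (Fin (nV G)) λ v → Σ (Fin (nE G)) λ e →
    (classify G d a ≡ inj₁ (inj₁ v)) × (classify G d b ≡ inj₁ (inj₂ e)) × Incident G v e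
decRel G d 𝒳 decoration (a ∷ []) = Σ (Fin d) λ X → classify G d a ≡ inj₂ X
decRel G d 𝒳 element (a ∷ b ∷ []) =
  Σ (Fin (nV G)) λ v → Σ (Fin d) λ X →
    (classify G d a ≡ inj₁ (inj₁ v)) × (classify G d b ≡ inj₂ X) × (v ∈ 𝒳 X)

decorated : (G : Graph) (d : ℕ) → (Fin d → Subset (nV G)) → Structure BaseDecSig
decorated G d 𝒳 = record { size = (nV G + nE G) + d ; rel = decRel G d 𝒳 }

reductRel : ∀ {k} (B : Structure (DecSig k)) (R : BaseDecSym) →
            Vec (Fin (size B)) (baseDecArity R) → Set
reductRel B incident   t = rel B incident t
reductRel B decoration t = rel B decoration t
reductRel B element    t = rel B element t

reduct : ∀ {k} → Structure (DecSig k) → Structure BaseDecSig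
reduct B = record { size = size B ; rel = reductRel B }

record EnrichedRep (k : ℕ) (G : Graph) (d : ℕ) (𝒳 : Fin d → Subset (nV G))
                   (B : Structure (DecSig k)) : Set where
  field
    represents : reduct B ≅ decorated G d 𝒳
    union      : (a b : Fin (size B)) →
                 rel B element (a ∷ b ∷ []) ⇔ (Σ (Fin k) λ i → rel B (elementAt i) (a ∷ b ∷ []))
    disjoint   : (i j : Fin k) (a b : Fin (size B)) →
                 rel B (elementAt i) (a ∷ b ∷ []) → rel B (elementAt j) (a ∷ b ∷ []) → i ≡ j
    functional : (i : Fin k) (a a' b : Fin (size B)) →
                 rel B (elementAt i) (a ∷ b ∷ []) → rel B (elementAt i) (a' ∷ b ∷ []) → a ≡ a'

module Submission where

-- Fix a proper colouring of Λ.  For X ∈ 𝒳 let w be a vertex with X ⊆ Λ(w) (its anchor);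
-- each u ∈ X is the root of a tree of Λ through w, and these trees have pairwise different
-- colours.  So the member of X of colour a is the root of the unique colour-a tree through w,
-- which MSO can find as "a colour-a root reachable from w along colour-a tree edges", provided
-- the colour-a roots and tree edges are marked.  X itself is determined by w and its palette
-- (the set of colours of its members), so the decoration X can be placed on a copy of w
-- indexed by the palette, one of 2^k copies.  All markings are guessed by a single colouring
-- step on k + 2 further copies of the structure.

open import Defs
open import Level using (lift)
open import Data.Nat using (ℕ; zero; suc; _+_; _*_; _^_; _≤_)
open import Data.Bool.Properties using (T-≡)
open import Data.Fin using (Fin; zero; suc; funToFin; finToFun; _↑ˡ_; _↑ʳ_; splitAt; join; _≟_)
open import Data.Fin.Properties using (*↔×; 2↔Bool; finToFun-funToFin; join-splitAt; splitAt-↑ˡ; splitAt-↑ʳ; splitAt-join; splitAt⁻¹-↑ˡ; splitAt⁻¹-↑ʳ; ↑ˡ-injective; suc-injective; 0≢1+n; any?)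
open import Data.Fin.Subset using (Subset; _∈_; _⊆_; ∁; ⊤; ∣_∣)
open import Data.Fin.Subset.Properties using (_∈?_; ∈⊤; ⊆-antisym; x∈∁p⇒x∉p; x∉p⇒x∈∁p)
open import Data.Vec using (Vec; []; _∷_; map; tabulate; lookup)
open import Data.Vec.Properties using (map-id; lookup∘tabulate; tabulate∘lookup; tabulate-cong; []=⇒lookup; lookup⇒[]=; ∷-injectiveˡ; ∷-injectiveʳ)
open import Data.Vec.Properties.WithK using ([]=-irrelevant)
open import Data.Product using (Σ; _×_; _,_; proj₁; proj₂)
open import Data.Product.Properties using (≡-dec)
open import Data.Sum using (_⊎_; inj₁; inj₂)
open import Data.Sum.Properties using (inj₁-injective; inj₂-injective)
open import Data.Unit using (tt) renaming (⊤ to Unit)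
open import Data.Empty using (⊥; ⊥-elim)
open import Relation.Nullary using (Dec; yes; no; does)
open import Relation.Nullary.Decidable using (toWitness; dec-true; isYes≗does; _×-dec_)
open import Relation.Unary using (Decidable)
open import Relation.Binary.PropositionalEquality using (_≡_; refl; sym; trans; cong; cong₂; subst; subst₂; module ≡-Reasoning)
open import Function using (_∘_)
open import Function.Bundles using (_↔_; _⇔_; Inverse; Equivalence; mk⇔)
open import Function.Definitions using (Injective)
open import Function.Properties.Inverse using (↔-refl)
open import Function.Construct.Identity using (⇔-id)

⟦_⟧ : ∀ {m} {P : Fin m → Set} → Decidable P → Subset m
⟦ P? ⟧ = tabulate (λ x → does (P? x))

∈⟦⟧ : ∀ {m} {P : Fin m → Set} (P? : Decidable P) {x : Fin m} → x ∈ ⟦ P? ⟧ ⇔ P x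
∈⟦⟧ P? {x} = mk⇔
  (λ x∈ → toWitness {a? = P? x} (Equivalence.from T-≡ (trans (isYes≗does (P? x)) (trans (sym (lookup∘tabulate _ x)) ([]=⇒lookup x∈)))))
  (λ Px → lookup⇒[]= x _ (trans (lookup∘tabulate _ x) (dec-true (P? x) Px)))

subsetCode : ∀ {m} → Subset m → Fin (2 ^ m)
subsetCode S = funToFin (λ x → Inverse.from 2↔Bool (lookup S x))

subsetCode-injective : ∀ {m} (S S′ : Subset m) → subsetCode S ≡ subsetCode S′ → S ≡ S′
subsetCode-injective S S′ eq = begin
  S                         ≡⟨ sym (tabulate∘lookup S) ⟩
  tabulate (lookup S)       ≡⟨ tabulate-cong sameEntries ⟩
  tabulate (lookup S′)      ≡⟨ tabulate∘lookup S′ ⟩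
  S′                        ∎
  where
  open ≡-Reasoning
  decode : ∀ (U : Subset _) x → Inverse.to 2↔Bool (finToFun (subsetCode U) x) ≡ lookup U x
  decode U x = trans (cong (Inverse.to 2↔Bool) (finToFun-funToFin _ x)) (Inverse.strictlyInverseˡ 2↔Bool (lookup U x))
  sameEntries : ∀ x → lookup S x ≡ lookup S′ x
  sameEntries x = trans (sym (decode S x)) (trans (cong (λ c → Inverse.to 2↔Bool (finToFun c x)) eq) (decode S′ x))

data Side (m n : ℕ) : Fin (m + n) → Set where
  left  : (x : Fin m) → Side m n (x ↑ˡ n)
  right : (y : Fin n) → Side m n (m ↑ʳ y)

side : ∀ m n (b : Fin (m + n)) → Side m n b
side m n b with splitAt m b in eq
... | inj₁ x = subst (Side m n) (trans (cong (join m n) (sym eq)) (join-splitAt m n b)) (left x)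
... | inj₂ y = subst (Side m n) (trans (cong (join m n) (sym eq)) (join-splitAt m n b)) (right y)

module CanonicalCopy {σ : Signature} (A : Structure σ) (c : ℕ) where
  address : Fin (c * size A) ↔ (Fin c × Fin (size A))
  address = *↔×

  copyRel : (R : CopySym σ c) → Vec (Fin (c * size A)) (copyArity R) → Set
  copyRel (old R)   t = Σ (Fin c) λ l → Σ (Vec (Fin (size A)) (arity σ R)) λ s →
                          (map (Inverse.to address) t ≡ map (l ,_) s) × rel A R s
  copyRel copy      (a ∷ b ∷ []) = proj₂ (Inverse.to address a) ≡ proj₂ (Inverse.to address b)
  copyRel (layer l) (a ∷ [])     = proj₁ (Inverse.to address a) ≡ l

  structure : Structure (copySig σ c)
  structure = record { size = c * size A ; rel = copyRel }

  output : CopyOut c A structure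
  output = record { g = address ; oldRel = λ _ _ → ⇔-id _ ; copyRel = λ _ _ → ⇔-id _ ; layerRel = λ _ _ → ⇔-id _ }

module CanonicalColour {σ : Signature} (A : Structure σ) (P : Fin (size A) → Set) where
  colourRel : (R : Sym σ ⊎ Unit) → Vec (Fin (size A)) (colorArity σ R) → Set
  colourRel (inj₁ R) t        = rel A R t
  colourRel (inj₂ _) (a ∷ []) = P a

  structure : Structure (colorSig σ)
  structure = record { size = size A ; rel = colourRel }

  output : ColorOut A structure
  output = record { f = ↔-refl ; oldRel = λ R t →
    mk⇔ (subst (rel A R) (sym (map-id t))) (subst (rel A R) (map-id t)) }

⋁ : ∀ {σ i j m} → (Fin m → Formula σ i j) → Formula σ i j
⋁ {m = zero}  φ = false
⋁ {m = suc m} φ = or (φ zero) (⋁ (φ ∘ suc))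

module _ {σ i j} (A : Structure σ) (ρ : Fin i → Fin (size A)) (η : Fin j → Subset (size A)) where
  ⋁-sound : ∀ {m} (φ : Fin m → Formula σ i j) → Sat A (⋁ φ) ρ η → Σ (Fin m) λ x → Sat A (φ x) ρ η
  ⋁-sound {suc m} φ (inj₁ s) = zero , s
  ⋁-sound {suc m} φ (inj₂ s) with ⋁-sound (φ ∘ suc) s
  ... | x , s′ = suc x , s′

  ⋁-complete : ∀ {m} (φ : Fin m → Formula σ i j) → Σ (Fin m) (λ x → Sat A (φ x) ρ η) → Sat A (⋁ φ) ρ η
  ⋁-complete {suc m} φ (zero  , s) = inj₁ s
  ⋁-complete {suc m} φ (suc x , s) = inj₂ (⋁-complete (φ ∘ suc) (x , s))

  ⋁-sat : ∀ {m} (φ : Fin m → Formula σ i j) → Sat A (⋁ φ) ρ η ⇔ (Σ (Fin m) λ x → Sat A (φ x) ρ η)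
  ⋁-sat φ = mk⇔ (⋁-sound φ) (⋁-complete φ)

module ColouredGuidance {G : Graph} (Λ : GuidanceSystem G) {k : ℕ} (colouring : Colorable k Λ) where

  colour : Fin (count Λ) → Fin k
  colour = proj₁ colouring

  T : Fin (count Λ) → RootedSubtree G
  T = tree Λ

  same-colour-tree : ∀ {i j v} → colour i ≡ colour j → v ∈ verts (T i) → v ∈ verts (T j) → i ≡ j
  same-colour-tree {i} {j} {v} same v∈i v∈j with i ≟ j
  ... | yes i≡j = i≡j
  ... | no  i≢j = ⊥-elim (proj₂ colouring i j i≢j same v v∈i v∈j)

  endpoint-in-tree : ∀ j {v e} → e ∈ edges (T j) → Incident G v e → v ∈ verts (T j)
  endpoint-in-tree j e∈ (inj₁ refl) = proj₁ (endsIn (T j) _ e∈)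
  endpoint-in-tree j e∈ (inj₂ refl) = proj₂ (endsIn (T j) _ e∈)

  ColourClosed : Fin k → Subset (nV G) → Set
  ColourClosed a U = ∀ {u v e j} → colour j ≡ a → e ∈ edges (T j) →
                     Incident G u e → Incident G v e → u ∈ U → v ∈ U

  -- x is reachable from w along trees of colour a, phrased (as MSO can) by closed sets.
  Reach : Fin k → Fin (nV G) → Fin (nV G) → Set
  Reach a w x = ∀ U → ColourClosed a U → w ∈ U → x ∈ U

  IsRoot : Fin k → Fin (nV G) → Set
  IsRoot a v = Σ (Fin (count Λ)) λ j → (colour j ≡ a) × (root (T j) ≡ v)

  InTreeEdge : Fin k → Fin (nE G) → Set
  InTreeEdge a e = Σ (Fin (count Λ)) λ j → (colour j ≡ a) × (e ∈ edges (T j))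

  reach-in-tree : ∀ {a j w x} → colour j ≡ a → w ∈ verts (T j) → x ∈ verts (T j) → Reach a w x
  reach-in-tree {j = j} cj w∈ x∈ U closed = walk (conn (T j) _ _ w∈ x∈)
    where
    walk : ∀ {u v} → Connected G (edges (T j)) u v → u ∈ U → v ∈ U
    walk here                    u∈U = u∈U
    walk (step e e∈ inc inc′ rest) u∈U = walk rest (closed cj e∈ inc inc′ u∈U)

  -- The vertices outside a tree of colour a form an a-closed set: trees of colour a are disjoint.
  outside-closed : ∀ {a j} → colour j ≡ a → ColourClosed a (∁ (verts (T j)))
  outside-closed {j = j} cj {j = j′} cj′ e∈ inc inc′ u∉ = x∉p⇒x∈∁p λ v∈ →
    x∈∁p⇒x∉p u∉ (subst (λ t → _ ∈ verts (T t))
      (sym (same-colour-tree (trans cj (sym cj′)) v∈ (endpoint-in-tree j′ e∈ inc′)))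
      (endpoint-in-tree j′ e∈ inc))

  reach-root : ∀ {a j w} → colour j ≡ a → Reach a w (root (T j)) → w ∈ verts (T j)
  reach-root {j = j} {w} cj reach with w ∈? verts (T j)
  ... | yes w∈ = w∈
  ... | no  w∉ = ⊥-elim (x∈∁p⇒x∉p (reach _ (outside-closed cj) (x∉p⇒x∈∁p w∉)) (rootIn (T j)))

module Captured {G : Graph} (Λ : GuidanceSystem G) {k : ℕ} (colouring : Colorable k Λ)
                {d : ℕ} (𝒳 : Fin d → Subset (nV G)) (captured : Captures Λ 𝒳) where
  open ColouredGuidance Λ colouring public

  anchor : Fin d → Fin (nV G)
  anchor X = proj₁ (captured X)

  guide : ∀ X {u} → u ∈ 𝒳 X → Fin (count Λ)
  guide X u∈ = proj₁ (proj₂ (captured X) _ u∈)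

  guide-anchor : ∀ X {u} (u∈ : u ∈ 𝒳 X) → anchor X ∈ verts (T (guide X u∈))
  guide-anchor X u∈ = proj₁ (proj₂ (proj₂ (captured X) _ u∈))

  guide-root : ∀ X {u} (u∈ : u ∈ 𝒳 X) → root (T (guide X u∈)) ≡ u
  guide-root X u∈ = proj₂ (proj₂ (proj₂ (captured X) _ u∈))

  memberColour : ∀ X {u} → u ∈ 𝒳 X → Fin k
  memberColour X u∈ = colour (guide X u∈)

  -- Membership proofs are unique, so the colour of a member depends only on the member.
  memberColour-unique : ∀ {X X′ u u′} (p : u ∈ 𝒳 X) (p′ : u′ ∈ 𝒳 X′) → X ≡ X′ → u ≡ u′ →
                        memberColour X p ≡ memberColour X′ p′
  memberColour-unique {X} p p′ refl refl = cong (memberColour X) ([]=-irrelevant p p′)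

  -- Members of X of equal colour coincide: both trees pass through the anchor.
  member-by-colour : ∀ {X X′ u u′} (p : u ∈ 𝒳 X) (p′ : u′ ∈ 𝒳 X′) → X ≡ X′ →
                     memberColour X p ≡ memberColour X′ p′ → u ≡ u′
  member-by-colour {X} p p′ refl same = trans (sym (guide-root X p))
    (trans (cong (λ j → root (T j)) (same-colour-tree same (guide-anchor X p) (guide-anchor X p′)))
           (guide-root X p′))

  HasColour : Fin d → Fin k → Fin (nV G) → Set
  HasColour X a u = Σ (u ∈ 𝒳 X) λ p → memberColour X p ≡ a

  hasColour? : ∀ X a u → Dec (HasColour X a u)
  hasColour? X a u with u ∈? 𝒳 X
  ... | no  u∉ = no λ (p , _) → u∉ p
  ... | yes p with memberColour X p ≟ a
  ...   | yes c≡a = yes (p , c≡a)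
  ...   | no  c≢a = no λ (q , c≡a) → c≢a (trans (memberColour-unique p q refl refl) c≡a)

  palette : Fin d → Subset k
  palette X = ⟦ (λ a → any? (hasColour? X a)) ⟧

  palette-intro : ∀ X {u} (p : u ∈ 𝒳 X) → memberColour X p ∈ palette X
  palette-intro X p = Equivalence.from (∈⟦⟧ (λ a → any? (hasColour? X a))) (_ , p , refl)

  palette-elim : ∀ {X a} → a ∈ palette X → Σ (Fin (nV G)) (HasColour X a)
  palette-elim {X} a∈ = Equivalence.to (∈⟦⟧ (λ a → any? (hasColour? X a))) a∈

  decode-member : ∀ {X a u} → a ∈ palette X → IsRoot a u → Reach a (anchor X) u → HasColour X a u
  decode-member {X} a∈ (j , cj , refl) reach with palette-elim a∈
  ... | u′ , p′ , c′ =
    subst (HasColour X _) (trans (sym (guide-root X p′)) (cong (λ i → root (T i)) guide≡j)) (p′ , c′)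
    where
    guide≡j : guide X p′ ≡ j
    guide≡j = same-colour-tree (trans c′ (sym cj)) (guide-anchor X p′) (reach-root cj reach)

  encode-member : ∀ X {u} (p : u ∈ 𝒳 X) → IsRoot (memberColour X p) u × Reach (memberColour X p) (anchor X) u
  encode-member X p = (guide X p , refl , guide-root X p) ,
    reach-in-tree refl (guide-anchor X p) (subst (_∈ verts (T (guide X p))) (guide-root X p) (rootIn (T (guide X p))))

  palette-⊆ : ∀ X Y → anchor X ≡ anchor Y → palette X ≡ palette Y → 𝒳 X ⊆ 𝒳 Y
  palette-⊆ X Y sameAnchor samePalette {u} p with encode-member X p
  ... | isRoot , reach = proj₁ (decode-member (subst (memberColour X p ∈_) samePalette (palette-intro X p)) isRoot
                                                (subst (λ w → Reach (memberColour X p) w u) sameAnchor reach))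

  signature : Fin d → Fin (2 ^ k) × Fin (nV G)
  signature X = subsetCode (palette X) , anchor X

  signature-injective : Injective _≡_ _≡_ 𝒳 → Injective _≡_ _≡_ signature
  signature-injective 𝒳-inj {X} {Y} eq = 𝒳-inj (⊆-antisym (palette-⊆ X Y sameAnchor samePalette)
                                                         (palette-⊆ Y X (sym sameAnchor) (sym samePalette)))
    where
    sameAnchor : anchor X ≡ anchor Y
    sameAnchor = cong proj₂ eq
    samePalette : palette X ≡ palette Y
    samePalette = subsetCode-injective _ _ (cong proj₁ eq)

-- Copy the graph into 1 + 2^k layers (layer 0 is the graph itself; the
-- decoration X will sit in layer 1 + code(palette X) above its anchor vertex), then copy
-- everything into 2 + k mark layers and colour with one predicate Q.  Q on mark layer 1 marks
-- decorations, Q on mark layer 2+a marks the colour-a data: roots and edges of colour-a trees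
-- and decorations whose palette contains a.  An interpretation keeps mark layer 0.
module Construction (k : ℕ) where
  copies : ℕ
  copies = suc (2 ^ k)

  marks : ℕ
  marks = suc (suc k)

  Σ₃ : Signature
  Σ₃ = colorSig (copySig (copySig GraphSig copies) marks)

  incidentS sameBaseS sameSiteS markS : Sym Σ₃
  incidentS = inj₁ (old (old incident))
  sameBaseS = inj₁ (old copy)
  sameSiteS = inj₁ copy
  markS     = inj₂ tt

  layerS : Fin copies → Sym Σ₃
  layerS l = inj₁ (old (layer l))

  markLayerS : Fin marks → Sym Σ₃
  markLayerS m = inj₁ (layer m)

  -- x is marked in mark layer m: its copy in that layer satisfies Q.
  marked : ∀ {i j} → Fin marks → Fin i → Formula Σ₃ i j
  marked m x = exists₁ (and (atom sameSiteS (suc x ∷ zero ∷ []))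
                            (and (atom (markLayerS m) (zero ∷ [])) (atom markS (zero ∷ []))))

  isDecoration : ∀ {i j} → Fin i → Formula Σ₃ i j
  isDecoration = marked (suc zero)

  hasColour : ∀ {i j} → Fin k → Fin i → Formula Σ₃ i j
  hasColour a = marked (suc (suc a))

  domainF : Formula Σ₃ 1 0
  domainF = and (atom (markLayerS zero) (zero ∷ []))
                (or (atom (layerS zero) (zero ∷ [])) (isDecoration zero))

  incidentF : Formula Σ₃ 2 0
  incidentF = and (atom (layerS zero) (zero ∷ [])) (atom incidentS (zero ∷ suc zero ∷ []))

  -- The set variable Z is closed along edges marked with colour a (bound variables y z e).
  closedF : ∀ {n} → Fin k → Formula Σ₃ n 1
  closedF a = forall₁ (forall₁ (forall₁
    (implies (member (suc (suc zero)) zero)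
    (implies (hasColour a zero)
    (implies (atom incidentS (suc (suc zero) ∷ zero ∷ []))
    (implies (atom incidentS (suc zero ∷ zero ∷ []))
             (member (suc zero) zero)))))))

  reachF : ∀ {n} → Fin k → Fin n → Fin n → Formula Σ₃ n 0
  reachF a x w = forall₂ (implies (member w zero) (implies (closedF a) (member x zero)))

  -- element_a(u, X): u has colour a, a is in the palette of X, and u is reachable along
  -- colour a from the layer-0 vertex below X (its anchor).
  elementF : Fin k → Formula Σ₃ 2 0
  elementF a = and (isDecoration (suc zero)) (and (hasColour a (suc zero)) (and (hasColour a zero)
    (exists₁ (and (atom (layerS zero) (zero ∷ []))
             (and (atom sameBaseS (zero ∷ suc (suc zero) ∷ []))
                  (reachF a (suc zero) zero))))))

  outputFormula : (R : DecSym k) → Formula Σ₃ (decArity R) 0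
  outputFormula incident      = incidentF
  outputFormula decoration    = isDecoration zero
  outputFormula element       = ⋁ elementF
  outputFormula (elementAt a) = elementF a

  interpretation : Interpretation Σ₃ (DecSig k)
  interpretation = record { domain = domainF ; formula = outputFormula }

  transduction : Transduction GraphSig (DecSig k)
  transduction = copying copies ⨾ (copying marks ⨾ (coloring ⨾ interpret interpretation))

module Run (k : ℕ) (G : Graph) where
  open Construction k public

  n : ℕ
  n = nV G + nE G

  Position : Set
  Position = Fin copies × Fin n

  module Layers (mark : Fin marks → Position → Set) where
    module Copy₁ = CanonicalCopy (encode G) copies
    module Copy₂ = CanonicalCopy Copy₁.structure marks

    address₁ : Fin (copies * n) ↔ Position
    address₁ = Copy₁.address

    address₂ : Fin (marks * (copies * n)) ↔ (Fin marks × Fin (copies * n))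
    address₂ = Copy₂.address

    site : Fin (marks * (copies * n)) → Fin marks × Fin (copies * n)
    site = Inverse.to address₂

    markOf : Fin (marks * (copies * n)) → Fin marks
    markOf z = proj₁ (site z)

    pos : Fin (marks * (copies * n)) → Position
    pos z = Inverse.to address₁ (proj₂ (site z))

    module Colour = CanonicalColour Copy₂.structure (λ z → mark (markOf z) (pos z))

    A₃ : Structure Σ₃
    A₃ = Colour.structure

    Elt : Set
    Elt = Fin (size A₃)

    at : Fin marks → Position → Elt
    at m q = Inverse.from address₂ (m , Inverse.from address₁ q)

    site-at : ∀ m q → site (at m q) ≡ (m , Inverse.from address₁ q)
    site-at m q = Inverse.strictlyInverseˡ address₂ _

    markOf-at : ∀ m q → markOf (at m q) ≡ m
    markOf-at m q = cong proj₁ (site-at m q)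

    pos-at : ∀ m q → pos (at m q) ≡ q
    pos-at m q = trans (cong (λ s → Inverse.to address₁ (proj₂ s)) (site-at m q)) (Inverse.strictlyInverseˡ address₁ q)

    at-unique : ∀ z {m q} → markOf z ≡ m → pos z ≡ q → z ≡ at m q
    at-unique z {m} {q} refl refl = trans (sym (Inverse.strictlyInverseʳ address₂ z))
      (cong (λ y → Inverse.from address₂ (markOf z , y)) (sym (Inverse.strictlyInverseʳ address₁ (proj₂ (site z)))))

    module _ {i j} (ρ : Fin i → Elt) (η : Fin j → Subset (size A₃)) where
      marked-sound : ∀ m x → Sat A₃ (marked m x) ρ η → mark m (pos (ρ x))
      marked-sound m x (z , sameSite , refl , q) = subst (mark (markOf z)) (cong (Inverse.to address₁) (sym sameSite)) q

      marked-complete : ∀ m x → mark m (pos (ρ x)) → Sat A₃ (marked m x) ρ η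
      marked-complete m x isMarked = at m p , sameSite , markOf-at m p , subst₂ mark (sym (markOf-at m p)) (sym (pos-at m p)) isMarked
        where
        p = pos (ρ x)
        sameSite : proj₂ (site (ρ x)) ≡ proj₂ (site (at m p))
        sameSite = trans (sym (Inverse.strictlyInverseʳ address₁ _)) (sym (cong proj₂ (site-at m p)))

    layer-sound : ∀ {l a} → rel A₃ (layerS l) (a ∷ []) → proj₁ (pos a) ≡ l
    layer-sound (_ , (_ ∷ []) , eq , inLayer) = subst (λ y → proj₁ (Inverse.to address₁ y) ≡ _) (sym (cong proj₂ (∷-injectiveˡ eq))) inLayer

    layer-complete : ∀ {l a} → proj₁ (pos a) ≡ l → rel A₃ (layerS l) (a ∷ [])
    layer-complete {a = a} inLayer = markOf a , (proj₂ (site a) ∷ []) , refl , inLayer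

    sameBase-sound : ∀ {a b} → rel A₃ sameBaseS (a ∷ b ∷ []) → proj₂ (pos a) ≡ proj₂ (pos b)
    sameBase-sound (_ , (_ ∷ _ ∷ []) , eq , same) =
      trans (cong (λ s → proj₂ (Inverse.to address₁ (proj₂ s))) (∷-injectiveˡ eq))
        (trans same (sym (cong (λ s → proj₂ (Inverse.to address₁ (proj₂ s))) (∷-injectiveˡ (∷-injectiveʳ eq)))))

    sameBase-complete : ∀ {a b} → markOf a ≡ markOf b → proj₂ (pos a) ≡ proj₂ (pos b) → rel A₃ sameBaseS (a ∷ b ∷ [])
    sameBase-complete {a} {b} sameMark same = markOf a , (proj₂ (site a) ∷ proj₂ (site b) ∷ []) ,
      cong (λ m → site a ∷ (m , proj₂ (site b)) ∷ []) (sym sameMark) , same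

    Incidence : Elt → Elt → Set
    Incidence a b = (markOf a ≡ markOf b) × (proj₁ (pos a) ≡ proj₁ (pos b)) ×
                    encRel G incident (proj₂ (pos a) ∷ proj₂ (pos b) ∷ [])

    incidence-sound : ∀ {a b} → rel A₃ incidentS (a ∷ b ∷ []) → Incidence a b
    incidence-sound {a} {b} (_ , (_ ∷ _ ∷ []) , eq , l , (s₀ ∷ s₁ ∷ []) , eq′ , inc) =
      trans (cong proj₁ siteA) (sym (cong proj₁ siteB)) ,
      trans (cong proj₁ posA) (sym (cong proj₁ posB)) ,
      subst₂ (λ x y → encRel G incident (x ∷ y ∷ [])) (sym (cong proj₂ posA)) (sym (cong proj₂ posB)) inc
      where
      siteA = ∷-injectiveˡ eq
      siteB = ∷-injectiveˡ (∷-injectiveʳ eq)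
      posA : pos a ≡ (l , s₀)
      posA = trans (cong (λ s → Inverse.to address₁ (proj₂ s)) siteA) (∷-injectiveˡ eq′)
      posB : pos b ≡ (l , s₁)
      posB = trans (cong (λ s → Inverse.to address₁ (proj₂ s)) siteB) (∷-injectiveˡ (∷-injectiveʳ eq′))

    incidence-complete : ∀ {a b} → Incidence a b → rel A₃ incidentS (a ∷ b ∷ [])
    incidence-complete {a} {b} (sameMark , sameLayer , inc) =
      markOf a , (proj₂ (site a) ∷ proj₂ (site b) ∷ []) ,
      cong (λ m → site a ∷ (m , proj₂ (site b)) ∷ []) (sym sameMark) ,
      proj₁ (pos a) , (proj₂ (pos a) ∷ proj₂ (pos b) ∷ []) ,
      cong (λ l → pos a ∷ (l , proj₂ (pos b)) ∷ []) (sym sameLayer) , inc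

classify-left : ∀ G d (y : Fin (nV G + nE G)) → classify G d (y ↑ˡ d) ≡ inj₁ (splitAt (nV G) y)
classify-left G d y rewrite splitAt-↑ˡ (nV G + nE G) y d = refl

classify-right : ∀ G d (X : Fin d) → classify G d ((nV G + nE G) ↑ʳ X) ≡ inj₂ X
classify-right G d X rewrite splitAt-↑ʳ (nV G + nE G) d X = refl

unclassify : ∀ G d → (Fin (nV G) ⊎ Fin (nE G)) ⊎ Fin d → Fin ((nV G + nE G) + d)
unclassify G d (inj₁ ve) = join (nV G) (nE G) ve ↑ˡ d
unclassify G d (inj₂ X)  = (nV G + nE G) ↑ʳ X

classify-unclassify : ∀ G d c → classify G d (unclassify G d c) ≡ c
classify-unclassify G d (inj₁ ve) = trans (classify-left G d _) (cong inj₁ (splitAt-join (nV G) (nE G) ve))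
classify-unclassify G d (inj₂ X)  = classify-right G d X

unclassify-classify : ∀ G d b → unclassify G d (classify G d b) ≡ b
unclassify-classify G d b with side (nV G + nE G) d b
... | left y  = trans (cong (unclassify G d) (classify-left G d y)) (cong (_↑ˡ d) (join-splitAt (nV G) (nE G) y))
... | right X = cong (unclassify G d) (classify-right G d X)

classify-injective : ∀ G d → Injective _≡_ _≡_ (classify G d)
classify-injective G d {a} {b} eq = trans (sym (unclassify-classify G d a)) (trans (cong (unclassify G d) eq) (unclassify-classify G d b))

module Correctness (k : ℕ) (G : Graph) {d : ℕ} (𝒳 : Fin d → Subset (nV G)) (𝒳-injective : Injective _≡_ _≡_ 𝒳)
                   (Λ : GuidanceSystem G) (colouring : Colorable k Λ) (captured : Captures Λ 𝒳) where
  open Run k G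
  open Captured Λ colouring 𝒳 captured

  nv ne : ℕ
  nv = nV G
  ne = nE G

  Part : Set
  Part = (Fin nv ⊎ Fin ne) ⊎ Fin d

  positionOf : Part → Position
  positionOf (inj₁ ve) = zero , join nv ne ve
  positionOf (inj₂ X)  = suc (subsetCode (palette X)) , anchor X ↑ˡ ne

  positionOf-injective : Injective _≡_ _≡_ positionOf
  positionOf-injective {inj₁ ve} {inj₁ ve′} eq =
    cong inj₁ (trans (sym (splitAt-join nv ne ve)) (trans (cong (λ q → splitAt nv (proj₂ q)) eq) (splitAt-join nv ne ve′)))
  positionOf-injective {inj₂ X}  {inj₂ Y}   eq =
    cong inj₂ (signature-injective 𝒳-injective (cong₂ _,_ (suc-injective (cong proj₁ eq)) (↑ˡ-injective ne _ _ (cong proj₂ eq))))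
  positionOf-injective {inj₁ _}  {inj₂ _}   eq = ⊥-elim (0≢1+n (cong proj₁ eq))
  positionOf-injective {inj₂ _}  {inj₁ _}   eq = ⊥-elim (0≢1+n (sym (cong proj₁ eq)))

  vertexAt : Fin nv → Position
  vertexAt v = positionOf (inj₁ (inj₁ v))

  edgeAt : Fin ne → Position
  edgeAt e = positionOf (inj₁ (inj₂ e))

  Carries : Fin k → Part → Set
  Carries a (inj₁ (inj₁ v)) = IsRoot a v
  Carries a (inj₁ (inj₂ e)) = InTreeEdge a e
  Carries a (inj₂ X)        = a ∈ palette X

  Mark : Fin marks → Position → Set
  Mark zero           q = ⊥
  Mark (suc zero)     q = Σ (Fin d) λ X → q ≡ positionOf (inj₂ X)
  Mark (suc (suc a))  q = Σ Part λ c → (q ≡ positionOf c) × Carries a c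

  open Layers Mark

  elementOf : Part → Elt
  elementOf c = at zero (positionOf c)

  elementOf-mark : ∀ c → markOf (elementOf c) ≡ zero
  elementOf-mark c = markOf-at zero (positionOf c)

  elementOf-pos : ∀ c → pos (elementOf c) ≡ positionOf c
  elementOf-pos c = pos-at zero (positionOf c)

  vertex : Fin nv → Elt
  vertex v = elementOf (inj₁ (inj₁ v))

  edge : Fin ne → Elt
  edge e = elementOf (inj₁ (inj₂ e))

  module _ {i j} (ρ : Fin i → Elt) (η : Fin j → Subset (size A₃)) where
    colour-sound : ∀ {a} x c → Sat A₃ (hasColour a x) ρ η → pos (ρ x) ≡ positionOf c → Carries a c
    colour-sound {a} x c s at-c with marked-sound ρ η _ x s
    ... | c′ , at-c′ , carries = subst (Carries a) (positionOf-injective (trans (sym at-c′) at-c)) carries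

    colour-complete : ∀ {a} x c → Carries a c → pos (ρ x) ≡ positionOf c → Sat A₃ (hasColour a x) ρ η
    colour-complete {a} x c carries at-c = marked-complete ρ η (suc (suc a)) x (c , at-c , carries)

  incidence-view : ∀ {y y′} → encRel G incident (y ∷ y′ ∷ []) →
                   Σ (Fin nv) λ v → Σ (Fin ne) λ e → (y ≡ v ↑ˡ ne) × (y′ ≡ nv ↑ʳ e) × Incident G v e
  incidence-view (v , e , y-v , y′-e , inc) = v , e , sym (splitAt⁻¹-↑ˡ y-v) , sym (splitAt⁻¹-↑ʳ y′-e) , inc

  VertexEdge : Elt → Elt → Set
  VertexEdge y x = Σ (Fin nv) λ v → Σ (Fin ne) λ e → (pos y ≡ vertexAt v) × (pos x ≡ edgeAt e) × Incident G v e

  incidence-at-layer₀ : ∀ {y x} → Incidence y x → proj₁ (pos y) ≡ zero → VertexEdge y x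
  incidence-at-layer₀ (_ , sameLayer , inc) layer₀ with incidence-view inc
  ... | v , e , y-v , x-e , v-e = v , e , cong₂ _,_ layer₀ y-v , cong₂ _,_ (trans (sym sameLayer) layer₀) x-e , v-e

  vertexAt-injective : ∀ {u v} → vertexAt u ≡ vertexAt v → u ≡ v
  vertexAt-injective eq = inj₁-injective (inj₁-injective (positionOf-injective eq))

  edgeAt-injective : ∀ {e e′} → edgeAt e ≡ edgeAt e′ → e ≡ e′
  edgeAt-injective eq = inj₂-injective (inj₁-injective (positionOf-injective eq))

  incidence-from-vertex : ∀ {y x u} → Incidence y x → pos y ≡ vertexAt u → Σ (Fin ne) λ e → (pos x ≡ edgeAt e) × Incident G u e
  incidence-from-vertex {u = u} I y-u with incidence-at-layer₀ I (cong proj₁ y-u)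
  ... | v , e , y-v , x-e , v-e = e , x-e , subst (λ w → Incident G w e) (vertexAt-injective (trans (sym y-v) y-u)) v-e

  incidence-to-edge : ∀ {z x e} → Incidence z x → pos x ≡ edgeAt e → Σ (Fin nv) λ v → (pos z ≡ vertexAt v) × Incident G v e
  incidence-to-edge I@(_ , sameLayer , _) x-e with incidence-at-layer₀ I (trans sameLayer (cong proj₁ x-e))
  ... | v , e′ , z-v , x-e′ , v-e′ = v , z-v , subst (Incident G v) (edgeAt-injective (trans (sym x-e′) x-e)) v-e′

  incidence-vertex-edge : ∀ {u e} → Incident G u e → Incidence (vertex u) (edge e)
  incidence-vertex-edge {u} {e} inc =
    trans (elementOf-mark (inj₁ (inj₁ u))) (sym (elementOf-mark (inj₁ (inj₂ e)))) ,
    trans (cong proj₁ (elementOf-pos (inj₁ (inj₁ u)))) (sym (cong proj₁ (elementOf-pos (inj₁ (inj₂ e))))) ,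
    subst₂ (λ y y′ → encRel G incident (y ∷ y′ ∷ [])) (sym (cong proj₂ (elementOf-pos (inj₁ (inj₁ u))))) (sym (cong proj₂ (elementOf-pos (inj₁ (inj₂ e)))))
      (u , e , splitAt-↑ˡ nv u ne , splitAt-↑ʳ nv ne e , inc)

  AtVertexIn : Subset nv → Elt → Set
  AtVertexIn U z = Σ (Fin nv) λ v → v ∈ U × pos z ≡ vertexAt v

  atVertexIn? : ∀ U z → Dec (AtVertexIn U z)
  atVertexIn? U z = any? (λ v → (v ∈? U) ×-dec ≡-dec _≟_ _≟_ (pos z) (vertexAt v))

  verticesOn : Subset nv → Subset (size A₃)
  verticesOn U = ⟦ atVertexIn? U ⟧

  verticesIn : Subset (size A₃) → Subset nv
  verticesIn Z = ⟦ (λ v → vertex v ∈? Z) ⟧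

  closed-pushforward : ∀ {a U} → ColourClosed a U → ∀ {i} (ρ : Fin i → Elt) →
                       Sat A₃ (closedF a) ρ (extend noVars (verticesOn U))
  closed-pushforward {a} {U} closedU ρ y z e y∈ e-coloured y-e z-e
    with Equivalence.to (∈⟦⟧ (atVertexIn? U)) y∈
  ... | u , u∈U , y-u with incidence-from-vertex (incidence-sound y-e) y-u
  ...   | e′ , e-e′ , u-e′ with colour-sound (extend (extend (extend ρ y) z) e) (extend noVars (verticesOn U)) zero (inj₁ (inj₂ e′)) e-coloured e-e′
  ...     | j , cj , e′∈ with incidence-to-edge (incidence-sound z-e) e-e′
  ...       | v , z-v , v-e′ = Equivalence.from (∈⟦⟧ (atVertexIn? U)) (v , closedU cj e′∈ u-e′ v-e′ u∈U , z-v)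

  reach-sound : ∀ {i} (ρ : Fin i → Elt) {a} x w {w₀} → Sat A₃ (reachF a x w) ρ noVars → pos (ρ w) ≡ vertexAt w₀ →
                Σ (Fin nv) λ u → (pos (ρ x) ≡ vertexAt u) × Reach a w₀ u
  reach-sound ρ {a} x w {w₀} s w-w₀ = conclude (landsIn ⊤ (λ _ _ _ _ _ → ∈⊤) ∈⊤)
    where
    landsIn : ∀ U → ColourClosed a U → w₀ ∈ U → AtVertexIn U (ρ x)
    landsIn U closedU w₀∈ = Equivalence.to (∈⟦⟧ (atVertexIn? U))
      (s (verticesOn U) (Equivalence.from (∈⟦⟧ (atVertexIn? U)) (w₀ , w₀∈ , w-w₀)) (closed-pushforward closedU ρ))
    conclude : AtVertexIn ⊤ (ρ x) → Σ (Fin nv) λ u → (pos (ρ x) ≡ vertexAt u) × Reach a w₀ u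
    conclude (u , _ , x-u) = u , x-u , λ U closedU w₀∈ → inU U (landsIn U closedU w₀∈)
      where
      inU : ∀ U → AtVertexIn U (ρ x) → u ∈ U
      inU U (v , v∈ , x-v) = subst (_∈ U) (vertexAt-injective (trans (sym x-v) x-u)) v∈

  reach-complete : ∀ {i} (ρ : Fin i → Elt) {a} x w {w₀ u} → Reach a w₀ u → ρ w ≡ vertex w₀ → ρ x ≡ vertex u →
                   Sat A₃ (reachF a x w) ρ noVars
  reach-complete ρ {a} x w reach w-w₀ x-u Z w∈Z Z-closed =
    subst (_∈ Z) (sym x-u) (Equivalence.to (∈⟦⟧ inZ?) (reach (verticesIn Z) pulled-closed
      (Equivalence.from (∈⟦⟧ inZ?) (subst (_∈ Z) w-w₀ w∈Z))))
    where
    inZ? : Decidable (λ v → vertex v ∈ Z)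
    inZ? v = vertex v ∈? Z
    pulled-closed : ColourClosed a (verticesIn Z)
    pulled-closed {u′} {v′} {e} {j} cj e∈ u-e v-e u∈ = Equivalence.from (∈⟦⟧ inZ?)
      (Z-closed (vertex u′) (vertex v′) (edge e) (Equivalence.to (∈⟦⟧ inZ?) u∈)
        (colour-complete (extend (extend (extend ρ (vertex u′)) (vertex v′)) (edge e)) (extend noVars Z) zero (inj₁ (inj₂ e))
           (j , cj , e∈) (elementOf-pos (inj₁ (inj₂ e))))
        (incidence-complete (incidence-vertex-edge u-e)) (incidence-complete (incidence-vertex-edge v-e)))

  out : Fin ((nv + ne) + d) → Elt
  out b = elementOf (classify G d b)

  markOf-out : ∀ b → markOf (out b) ≡ zero
  markOf-out b = elementOf-mark (classify G d b)

  out-at : ∀ {b c} → classify G d b ≡ c → pos (out b) ≡ positionOf c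
  out-at {b} eq = trans (elementOf-pos (classify G d b)) (cong positionOf eq)

  classify-by-position : ∀ {b c} → pos (out b) ≡ positionOf c → classify G d b ≡ c
  classify-by-position {b} eq = positionOf-injective (trans (sym (elementOf-pos (classify G d b))) eq)

  out-injective : Injective _≡_ _≡_ out
  out-injective {a} {b} eq = classify-injective G d (classify-by-position (trans (cong pos eq) (out-at {b} refl)))

  part-in-domain : ∀ c → Sat A₃ domainF (λ _ → elementOf c) noVars
  part-in-domain c@(inj₁ _) = elementOf-mark c , inj₁ (layer-complete (cong proj₁ (elementOf-pos c)))
  part-in-domain c@(inj₂ X) = elementOf-mark c ,
    inj₂ (marked-complete (λ (_ : Fin 1) → elementOf c) noVars (suc zero) zero (X , elementOf-pos c))

  part-landing : ∀ {a} c → markOf a ≡ zero → pos a ≡ positionOf c → Σ (Fin ((nv + ne) + d)) λ b → out b ≡ a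
  part-landing {a} c mark₀ a-c = unclassify G d c , trans (cong elementOf (classify-unclassify G d c)) (sym (at-unique a mark₀ a-c))

  domain-onto : ∀ a → Sat A₃ domainF (λ _ → a) noVars → Σ (Fin ((nv + ne) + d)) λ b → out b ≡ a
  domain-onto a (mark₀ , inj₁ layer₀) =
    part-landing (inj₁ (splitAt nv (proj₂ (pos a)))) mark₀ (cong₂ _,_ (layer-sound layer₀) (sym (join-splitAt nv ne _)))
  domain-onto a (mark₀ , inj₂ deco) with marked-sound (λ (_ : Fin 1) → a) noVars (suc zero) zero deco
  ... | X , a-X = part-landing (inj₂ X) mark₀ a-X

  ElementOf : Fin k → Fin ((nv + ne) + d) → Fin ((nv + ne) + d) → Set
  ElementOf a b b′ = Σ (Fin nv) λ u → Σ (Fin d) λ X →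
    (classify G d b ≡ inj₁ (inj₁ u)) × (classify G d b′ ≡ inj₂ X) × HasColour X a u

  outputs : Fin ((nv + ne) + d) → Fin ((nv + ne) + d) → Fin 2 → Elt
  outputs b b′ = lookup (out b ∷ out b′ ∷ [])

  element-sound : ∀ a b b′ → Sat A₃ (elementF a) (outputs b b′) noVars → ElementOf a b b′
  element-sound a b b′ (deco , paletteMark , rootMark , w , w-layer , w-base , reach) =
    atDecoration (marked-sound (outputs b b′) noVars (suc zero) (suc zero) deco)
    where
    atDecoration : Σ (Fin d) (λ X → pos (out b′) ≡ positionOf (inj₂ X)) → ElementOf a b b′
    atDecoration (X , b′-X) = atVertex (reach-sound (extend (outputs b b′) w) (suc zero) zero reach w-anchor)
      where
      w-anchor : pos w ≡ vertexAt (anchor X)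
      w-anchor = cong₂ _,_ (layer-sound w-layer) (trans (sameBase-sound w-base) (cong proj₂ b′-X))
      atVertex : Σ (Fin nv) (λ u → (pos (out b) ≡ vertexAt u) × Reach a (anchor X) u) → ElementOf a b b′
      atVertex (u , b-u , reachable) = u , X , classify-by-position b-u , classify-by-position b′-X ,
        decode-member (colour-sound (outputs b b′) noVars (suc zero) (inj₂ X) paletteMark b′-X)
                      (colour-sound (outputs b b′) noVars zero (inj₁ (inj₁ u)) rootMark b-u) reachable

  element-complete : ∀ b b′ {u X} (p : u ∈ 𝒳 X) → classify G d b ≡ inj₁ (inj₁ u) → classify G d b′ ≡ inj₂ X →
                     Sat A₃ (elementF (memberColour X p)) (outputs b b′) noVars
  element-complete b b′ {u} {X} p b-u b′-X =
    marked-complete (outputs b b′) noVars (suc zero) (suc zero) (X , out-at b′-X) ,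
    colour-complete (outputs b b′) noVars (suc zero) (inj₂ X) (palette-intro X p) (out-at b′-X) ,
    colour-complete (outputs b b′) noVars zero (inj₁ (inj₁ u)) (proj₁ (encode-member X p)) (out-at b-u) ,
    vertex (anchor X) ,
    layer-complete {a = vertex (anchor X)} (cong proj₁ (elementOf-pos (inj₁ (inj₁ (anchor X))))) ,
    sameBase-complete {vertex (anchor X)} {out b′} (trans (elementOf-mark (inj₁ (inj₁ (anchor X)))) (sym (markOf-out b′)))
                      (trans (cong proj₂ (elementOf-pos (inj₁ (inj₁ (anchor X))))) (sym (cong proj₂ (out-at b′-X)))) ,
    reach-complete (extend (outputs b b′) (vertex (anchor X))) (suc zero) zero (proj₂ (encode-member X p)) refl (cong elementOf b-u)

  B : Structure (DecSig k)
  B = record { size = (nv + ne) + d ; rel = λ R t → Sat A₃ (outputFormula R) (lookup (map out t)) noVars }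

  interpreted : InterpOut interpretation A₃ B
  interpreted = record { f = out ; f-inj = out-injective ; f-dom = λ b → part-in-domain (classify G d b)
                       ; f-onto = domain-onto ; relOK = λ _ _ → ⇔-id _ }

  run : Out transduction (encode G) B
  run = Copy₁.structure , lift Copy₁.output ,
        (Copy₂.structure , lift Copy₂.output , (A₃ , lift Colour.output , lift interpreted))

  incident-sound : ∀ b b′ → rel B incident (b ∷ b′ ∷ []) → decRel G d 𝒳 incident (b ∷ b′ ∷ [])
  incident-sound b b′ (layer₀ , inc) =
    atParts (incidence-at-layer₀ (incidence-sound {out b} {out b′} inc) (layer-sound {zero} {out b} layer₀))
    where
    atParts : VertexEdge (out b) (out b′) → decRel G d 𝒳 incident (b ∷ b′ ∷ [])
    atParts (v , e , b-v , b′-e , v-e) = v , e , classify-by-position b-v , classify-by-position b′-e , v-e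

  incident-complete : ∀ b b′ → decRel G d 𝒳 incident (b ∷ b′ ∷ []) → rel B incident (b ∷ b′ ∷ [])
  incident-complete b b′ (v , e , b-v , b′-e , v-e) = layer-complete {zero} {out b} (cong proj₁ (out-at b-v)) ,
    incidence-complete {out b} {out b′}
      (subst₂ Incidence (cong elementOf (sym b-v)) (cong elementOf (sym b′-e)) (incidence-vertex-edge v-e))

  element-union : ∀ b b′ → rel B element (b ∷ b′ ∷ []) ⇔ (Σ (Fin k) λ a → rel B (elementAt a) (b ∷ b′ ∷ []))
  element-union b b′ = ⋁-sat A₃ (outputs b b′) noVars elementF

  element-exact : ∀ b b′ → rel B element (b ∷ b′ ∷ []) ⇔ decRel G d 𝒳 element (b ∷ b′ ∷ [])
  element-exact b b′ = mk⇔
    (λ s → let (a , sₐ) = Equivalence.to (element-union b b′) s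
               (u , X , b-u , b′-X , p , _) = element-sound a b b′ sₐ in u , X , b-u , b′-X , p)
    (λ (u , X , b-u , b′-X , p) → Equivalence.from (element-union b b′) (_ , element-complete b b′ p b-u b′-X))

  preserves : (R : BaseDecSym) (t : Vec (Fin ((nv + ne) + d)) (baseDecArity R)) →
              rel (reduct B) R t ⇔ rel (decorated G d 𝒳) R (map (Inverse.to (↔-refl {A = Fin ((nv + ne) + d)})) t)
  preserves incident   (b ∷ b′ ∷ []) = mk⇔ (incident-sound b b′) (incident-complete b b′)
  preserves decoration (b ∷ [])      = mk⇔
    (λ s → let (X , b-X) = marked-sound (lookup (out b ∷ [])) noVars (suc zero) zero s in X , classify-by-position b-X)
    (λ (X , b-X) → marked-complete (lookup (out b ∷ [])) noVars (suc zero) zero (X , out-at b-X))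
  preserves element    (b ∷ b′ ∷ []) = element-exact b b′

  colour-disjoint : (a a′ : Fin k) (b b′ : Fin ((nv + ne) + d)) →
                    rel B (elementAt a) (b ∷ b′ ∷ []) → rel B (elementAt a′) (b ∷ b′ ∷ []) → a ≡ a′
  colour-disjoint a a′ b b′ s s′ = sameColour (element-sound a b b′ s) (element-sound a′ b b′ s′)
    where
    sameColour : ElementOf a b b′ → ElementOf a′ b b′ → a ≡ a′
    sameColour (u , X , b-u , b′-X , p , c) (u′ , X′ , b-u′ , b′-X′ , p′ , c′) =
      trans (sym c) (trans (memberColour-unique p p′ (inj₂-injective (trans (sym b′-X) b′-X′))
                                                     (inj₁-injective (inj₁-injective (trans (sym b-u) b-u′)))) c′)

  colour-functional : (a : Fin k) (b₁ b₂ b′ : Fin ((nv + ne) + d)) →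
                      rel B (elementAt a) (b₁ ∷ b′ ∷ []) → rel B (elementAt a) (b₂ ∷ b′ ∷ []) → b₁ ≡ b₂
  colour-functional a b₁ b₂ b′ s s′ = sameMember (element-sound a b₁ b′ s) (element-sound a b₂ b′ s′)
    where
    sameMember : ElementOf a b₁ b′ → ElementOf a b₂ b′ → b₁ ≡ b₂
    sameMember (u , X , b₁-u , b′-X , p , c) (u′ , X′ , b₂-u′ , b′-X′ , p′ , c′) =
      classify-injective G d (trans b₁-u (trans (cong (λ v → inj₁ (inj₁ v)) u≡u′) (sym b₂-u′)))
      where
      u≡u′ : u ≡ u′
      u≡u′ = member-by-colour p p′ (inj₂-injective (trans (sym b′-X) b′-X′)) (trans c (sym c′))

  enriched : EnrichedRep k G d 𝒳 B
  enriched = record { represents = record { bij = ↔-refl ; pres = preserves }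
                    ; union = element-union ; disjoint = colour-disjoint ; functional = colour-functional }

mainTheorem8 : (k : ℕ) →
    Σ (Transduction GraphSig (DecSig k)) λ T →
      (G : Graph) (d : ℕ) (𝒳 : Fin d → Subset (nV G)) →
      Injective _≡_ _≡_ 𝒳 →
      ((X : Fin d) → ∣ 𝒳 X ∣ ≤ k) →
      Σ (GuidanceSystem G) (λ Λ → Captures Λ 𝒳 × Colorable k Λ) →
      Σ (Structure (DecSig k)) λ B → Out T (encode G) B × EnrichedRep k G d 𝒳 B
mainTheorem8 k = Construction.transduction k , λ G d 𝒳 𝒳-injective _ (Λ , captured , colouring) →
  let open Correctness k G 𝒳 𝒳-injective Λ colouring captured in B , run , enriched
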